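{- Let $\mathcal{C} = \{a_1 \pmod{d_1}, \ldots, a_n \pmod{d_n}\}$ be a covering system with distinct moduli $1 < d_1 < \cdots < d_n$ such that it is not the case that $2$, $3$ and $6$ all occur among the moduli $d_1, \ldots, d_n$. Then $\mathcal{C}$ is a CDL covering system, i.e. there exist pairwise distinct primes $p_1, \ldots, p_n$ with $p_i \mid 2^{d_i} - 1$ for each $1 \le i \le n$.
   Context: A covering system is a finite collection of residue classes $a_i \pmod{d_i}$ (positive integer moduli) whose union is $\mathbb{Z}$. A covering system $\{a_1 \pmod{d_1}, \ldots, a_n \pmod{d_n}\}$ with distinct moduli is called a CDL covering system if there exist pairwise distinct primes $p_1,\ldots,p_n$ with $p_i \mid 2^{d_i}-1$ for $1 \le i \le n$. -}

module Defs where

open import Data.Nat using (ℕ; _<_; _^_; _∸_)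
open import Data.Integer using (ℤ; +_; _-_)
open import Data.Integer.Divisibility using () renaming (_∣_ to _∣ℤ_)
open import Data.Nat.Divisibility using (_∣_)
open import Data.Nat.Primality using (Prime)
open import Data.Fin using (Fin) renaming (_<_ to _<ᶠ_)
open import Data.Product using (Σ; ∃; _×_)
open import Relation.Binary.PropositionalEquality using (_≡_)
open import Relation.Nullary using (¬_)
open import Function.Definitions using (Injective)

IsCovering : (n : ℕ) → (a : Fin n → ℤ) → (d : Fin n → ℕ) → Set
IsCovering n a d = ∀ (x : ℤ) → ∃ λ (i : Fin n) → (+ d i) ∣ℤ (x - a i)

StrictlyIncreasing : (n : ℕ) → (Fin n → ℕ) → Set
StrictlyIncreasing n d = ∀ (i j : Fin n) → i <ᶠ j → d i < d j

OccursAmong : (n : ℕ) → (Fin n → ℕ) → ℕ → Set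
OccursAmong n d m = ∃ λ (i : Fin n) → d i ≡ m

IsCDL : (n : ℕ) → (d : Fin n → ℕ) → Set
IsCDL n d = Σ (Fin n → ℕ) λ p →
  Injective _≡_ _≡_ p × (∀ (i : Fin n) → Prime (p i) × p i ∣ (2 ^ d i ∸ 1))

{-# OPTIONS --safe #-}
-- By Bang's theorem (Zsigmondy's theorem for base 2), for every d > 1 except d = 6 the number
-- 2 ^ d - 1 has a primitive prime divisor p, one for which d is the order of 2 modulo p; such
-- primes are distinct for distinct d. The modulus 6 gets 7 (primitive for 3) when 2 is a modulus
-- and 3 (primitive for 2) otherwise, which clashes only if 2, 3 and 6 are all moduli.
--
-- For Bang's theorem write d = m P with P the product of the primes dividing d, and let A and B
-- be the products of 2 ^ (m y) - 1 over the divisors y of P with μ (P / y) = 1 and = -1, so that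
-- A / B is the cyclotomic value Φ_d(2). If 2 ^ d - 1 has no primitive prime divisor, lifting the
-- exponent at each prime p gives ν_p A ≤ ν_p B + ν_p P, hence A ∣ P B. On the other hand the
-- bounds 2 ^ (m y - 1) ≤ 2 ^ (m y) - 1 < 2 ^ (m y) give A > P B unless d is one of
-- 2, 3, 4, 6, 10, 12, 30, and for these d ≠ 6 a primitive prime divisor is exhibited.
module Submission where

open import Defs
open import Data.Integer using (ℤ)
open import Data.Fin using (Fin)
import Data.Fin.Properties as Fin

open import Data.Nat
open import Data.Nat.Properties
open import Data.Nat.Divisibility
open import Data.Nat.DivMod
open import Data.Nat.Primality
open import Data.Nat.Primality.Factorisation using (factorise; factorisationHasAllPrimeFactors)
open import Data.Nat.ListAction using (product)
open import Data.List using (List; []; _∷_; map; _++_)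
open import Data.List.Properties using (≡-dec)
open import Data.List.Relation.Unary.All as All using (All; []; _∷_)
open import Data.List.Relation.Unary.Any using (here; there; any?)
open import Data.List.Membership.Propositional using (_∈_; _∉_; find; lose)
open import Data.List.Membership.Propositional.Properties using (∈-map⁺; ∈-++⁺ˡ; ∈-++⁺ʳ)
open import Data.List.Membership.DecPropositional _≟_ using (_∈?_)
import Data.List.Membership.DecPropositional as DecMembership
open import Data.Nat.ListAction.Properties using (∈⇒∣product)
open import Data.Nat.Coprimality as Coprime using (Coprime; coprime-divisor; coprime-factors)
open import Data.Nat.Induction using (<-rec)
open import Data.Nat.Tactic.RingSolver using (solve-∀)
open import Data.Product using (∃; ∃₂; _×_; _,_; proj₁; proj₂)
open import Data.Sum using (_⊎_; inj₁; inj₂)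
open import Function using (_∘_)
open import Function.Definitions using (Injective)
open import Relation.Nullary
open import Relation.Nullary.Decidable using (_×-dec_; _→-dec_; _⊎-dec_; from-yes)
open import Relation.Binary.Definitions using (tri<; tri≈; tri>)
open import Relation.Unary using (Decidable)
open import Relation.Binary.PropositionalEquality

private
  variable
    a b e k m n p q r t u w x y z : ℕ
    Q : List ℕ

∣⇒>0 : 0 < n → m ∣ n → 0 < m
∣⇒>0 {m = zero}  0<n 0∣n = contradiction (0∣⇒≡0 0∣n) (n>0⇒n≢0 0<n)
∣⇒>0 {m = suc _} _   _   = z<s

n≢0∧n≢1⇒n≥2 : n ≢ 0 → n ≢ 1 → 2 ≤ n
n≢0∧n≢1⇒n≥2 {zero}        n≢0 _   = contradiction refl n≢0
n≢0∧n≢1⇒n≥2 {suc zero}    _   n≢1 = contradiction refl n≢1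
n≢0∧n≢1⇒n≥2 {suc (suc _)} _   _   = s≤s (s≤s z≤n)

prime≥2 : Prime p → 2 ≤ p
prime≥2 {p} pp = nonTrivial⇒n>1 p {{prime⇒nonTrivial pp}}

prime∣prime⇒≡ : Prime p → Prime q → p ∣ q → p ≡ q
prime∣prime⇒≡ pp pq p∣q with prime⇒irreducible pq p∣q
... | inj₁ refl = contradiction (prime≥2 pp) λ { (s≤s ()) }
... | inj₂ p≡q  = p≡q

prime∣2^⇒≡2 : Prime p → p ∣ 2 ^ a → p ≡ 2
prime∣2^⇒≡2 {a = zero}  pp p∣1 = contradiction (subst (2 ≤_) (∣1⇒≡1 p∣1) (prime≥2 pp)) λ { (s≤s ()) }
prime∣2^⇒≡2 {a = suc a} pp p∣2^[1+a] with euclidsLemma 2 (2 ^ a) pp p∣2^[1+a]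
... | inj₁ p∣2   = prime∣prime⇒≡ pp prime[2] p∣2
... | inj₂ p∣2^a = prime∣2^⇒≡2 {a = a} pp p∣2^a

odd-prime : Prime p → p ≢ 2 → ∃ λ w → p ≡ 1 + 2 * w
odd-prime {p} pp p≢2 with p % 2 | m≡m%n+[m/n]*n p 2 | m%n<n p 2
... | 0           | p≡ | _ = contradiction (sym (prime∣prime⇒≡ prime[2] pp (divides (p / 2) p≡))) p≢2
... | 1           | p≡ | _ = p / 2 , trans p≡ (cong suc (*-comm (p / 2) 2))
... | suc (suc _) | _  | s≤s (s≤s ())

prime∤⇒coprime : Prime p → p ∤ n → Coprime p n
prime∤⇒coprime pp p∤n (c∣p , c∣n) with prime⇒irreducible pp c∣p
... | inj₁ c≡1 = c≡1
... | inj₂ refl = contradiction c∣n p∤n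

∃prime∣ : 2 ≤ n → ∃ λ q → Prime q × q ∣ n
∃prime∣ {n} 2≤n with factorise n {{>-nonZero (<-trans z<s 2≤n)}}
... | record { factors = [] ; isFactorisation = n≡1 } = contradiction (subst (2 ≤_) n≡1 2≤n) λ { (s≤s ()) }
... | record { factors = q ∷ qs ; isFactorisation = n≡ ; factorsPrime = pq ∷ _ } =
  q , pq , divides (product qs) (trans n≡ (*-comm q (product qs)))

∃prime∣-≢ : 2 ≤ z → z ≢ p → p * p ∤ z → ∃ λ q → Prime q × q ∣ z × q ≢ p
∃prime∣-≢ {z} {p} 2≤z z≢p p²∤z with ∃prime∣ 2≤z
... | q , pq , q∣z with q ≟ p
...   | no  q≢p  = q , pq , q∣z , q≢p
...   | yes refl with q∣z
...     | divides z′ refl with ∃prime∣ (n≢0∧n≢1⇒n≥2 {z′} (λ { refl → contradiction 2≤z λ () })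
                                                     (λ { refl → z≢p (*-identityˡ q) }))
...       | r , pr , r∣z′ = r , pr , ∣-trans r∣z′ (m∣m*n q) , λ { refl → p²∤z (*-monoˡ-∣ r r∣z′) }

geometric : ℕ → ℕ → ℕ
geometric y zero    = 0
geometric y (suc n) = 1 + y * geometric y n

geometric>0 : 0 < n → 0 < geometric y n
geometric>0 {suc n} _ = z<s

*-geometric+1 : ∀ u n → u * geometric (1 + u) n + 1 ≡ (1 + u) ^ n
*-geometric+1 u zero    = cong (_+ 1) (*-zeroʳ u)
*-geometric+1 u (suc n) = begin
  u * (1 + (1 + u) * geometric (1 + u) n) + 1  ≡⟨ lemma u (geometric (1 + u) n) ⟩
  (1 + u) * (u * geometric (1 + u) n + 1)      ≡⟨ cong ((1 + u) *_) (*-geometric+1 u n) ⟩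
  (1 + u) * (1 + u) ^ n                        ∎
  where
  open ≡-Reasoning
  lemma : ∀ u g → u * (1 + (1 + u) * g) + 1 ≡ (1 + u) * (u * g + 1)
  lemma = solve-∀

mersenne : ℕ → ℕ
mersenne x = 2 ^ x ∸ 1

2^≡1+mersenne : ∀ x → 2 ^ x ≡ 1 + mersenne x
2^≡1+mersenne x = sym (m+[n∸m]≡n (m^n>0 2 x))

mersenne-* : ∀ a n → mersenne (a * n) ≡ mersenne a * geometric (2 ^ a) n
mersenne-* a n = begin
  2 ^ (a * n) ∸ 1                                ≡⟨ cong (_∸ 1) (sym (^-*-assoc 2 a n)) ⟩
  (2 ^ a) ^ n ∸ 1                                ≡⟨ cong (λ z → z ^ n ∸ 1) (2^≡1+mersenne a) ⟩
  (1 + mersenne a) ^ n ∸ 1                       ≡⟨ cong (_∸ 1) (sym (*-geometric+1 (mersenne a) n)) ⟩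
  mersenne a * geometric (1 + mersenne a) n + 1 ∸ 1  ≡⟨ m+n∸n≡m _ 1 ⟩
  mersenne a * geometric (1 + mersenne a) n      ≡⟨ cong (λ z → mersenne a * geometric z n) (sym (2^≡1+mersenne a)) ⟩
  mersenne a * geometric (2 ^ a) n               ∎
  where open ≡-Reasoning

mersenne-+ : ∀ a b → mersenne (a + b) ≡ 2 ^ a * mersenne b + mersenne a
mersenne-+ a b = +-cancelˡ-≡ 1 _ _ (begin
  1 + mersenne (a + b)                    ≡⟨ sym (2^≡1+mersenne (a + b)) ⟩
  2 ^ (a + b)                             ≡⟨ ^-distribˡ-+-* 2 a b ⟩
  2 ^ a * 2 ^ b                           ≡⟨ cong (2 ^ a *_) (2^≡1+mersenne b) ⟩
  2 ^ a * (1 + mersenne b)                ≡⟨ *-distribˡ-+ (2 ^ a) 1 (mersenne b) ⟩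
  2 ^ a * 1 + 2 ^ a * mersenne b          ≡⟨ cong (λ z → z * 1 + 2 ^ a * mersenne b) (2^≡1+mersenne a) ⟩
  (1 + mersenne a) * 1 + 2 ^ a * mersenne b  ≡⟨ lemma (mersenne a) (2 ^ a * mersenne b) ⟩
  1 + (2 ^ a * mersenne b + mersenne a)   ∎)
  where
  open ≡-Reasoning
  lemma : ∀ u v → (1 + u) * 1 + v ≡ 1 + (v + u)
  lemma = solve-∀

mersenne-∣ : a ∣ b → mersenne a ∣ mersenne b
mersenne-∣ {a} (divides n refl) =
  subst (mersenne a ∣_) (sym (trans (cong mersenne (*-comm n a)) (mersenne-* a n))) (m∣m*n _)

mersenne>0 : 0 < x → 0 < mersenne x
mersenne>0 {x} 0<x = +-cancelˡ-< 1 0 (mersenne x)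
  (subst (1 <_) (2^≡1+mersenne x) (^-monoʳ-< 2 ≤-refl 0<x))

2∤mersenne : 0 < x → 2 ∤ mersenne x
2∤mersenne {suc x} _ 2∣M = contradiction (∣1⇒≡1 2∣1) λ ()
  where
  2∣1 : 2 ∣ 1
  2∣1 = ∣m+n∣m⇒∣n (subst (2 ∣_) (trans (2^≡1+mersenne (suc x)) (+-comm 1 _)) (m∣m*n (2 ^ x))) 2∣M

module Valuation (pp : Prime p) where

  private
    instance
      _ : NonZero p
      _ = prime⇒nonZero pp

  p∣p^[1+k]*u : ∀ k u → p ∣ p ^ suc k * u
  p∣p^[1+k]*u k u = ∣m⇒∣m*n u (m∣m*n (p ^ k))

  decompose : ∀ n → 0 < n → ∃₂ λ k u → n ≡ p ^ k * u × p ∤ u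
  decompose = <-rec _ step
    where
    step : ∀ n → (∀ {m} → m < n → 0 < m → ∃₂ λ k u → m ≡ p ^ k * u × p ∤ u) →
           0 < n → ∃₂ λ k u → n ≡ p ^ k * u × p ∤ u
    step n rec 0<n with p ∣? n
    ... | no p∤n = 0 , n , sym (*-identityˡ n) , p∤n
    ... | yes (divides q refl) with rec (m<m*n q p {{>-nonZero 0<q}} (prime≥2 pp)) 0<q
      where
      0<q : 0 < q
      0<q = >-nonZero⁻¹ q {{m*n≢0⇒m≢0 q {{>-nonZero 0<n}}}}
    ... | k , u , refl , p∤u = suc k , u , lemma (p ^ k) u p , p∤u
      where
      lemma : ∀ a b c → a * b * c ≡ c * a * b
      lemma = solve-∀

  ν : ℕ → ℕ
  ν zero        = 0
  ν n@(suc _)   = proj₁ (decompose n z<s)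

  ν-spec : 0 < n → ∃ λ u → n ≡ p ^ ν n * u × p ∤ u
  ν-spec {suc n} _ = proj₂ (decompose (suc n) z<s)

  decomposition-unique : ∀ k j → p ^ k * u ≡ p ^ j * w → p ∤ u → p ∤ w → k ≡ j
  decomposition-unique zero    zero    _  _   _   = refl
  decomposition-unique {u} {w} zero (suc j) eq p∤u _ =
    contradiction (subst (p ∣_) (trans (sym eq) (*-identityˡ u)) (p∣p^[1+k]*u j w)) p∤u
  decomposition-unique {u} {w} (suc k) zero eq _ p∤w =
    contradiction (subst (p ∣_) (trans eq (*-identityˡ w)) (p∣p^[1+k]*u k u)) p∤w
  decomposition-unique {u} {w} (suc k) (suc j) eq p∤u p∤w =
    cong suc (decomposition-unique k j (*-cancelˡ-≡ _ _ p p^k*u≡p^j*w) p∤u p∤w)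
    where
    p^k*u≡p^j*w : p * (p ^ k * u) ≡ p * (p ^ j * w)
    p^k*u≡p^j*w = trans (sym (*-assoc p (p ^ k) u)) (trans eq (*-assoc p (p ^ j) w))

  ν-unique : n ≡ p ^ k * u → p ∤ u → ν n ≡ k
  ν-unique {zero} {k} {u} 0≡ p∤u with m*n≡0⇒m≡0∨n≡0 (p ^ k) (sym 0≡)
  ... | inj₁ p^k≡0 = contradiction p^k≡0 (≢-nonZero⁻¹ _ {{m^n≢0 p k}})
  ... | inj₂ refl  = contradiction (p ∣0) p∤u
  ν-unique {suc n} {k} n≡ p∤u with ν-spec {suc n} z<s
  ... | w , n≡′ , p∤w = decomposition-unique _ k (trans (sym n≡′) n≡) p∤w p∤u

  ν-* : 0 < a → 0 < b → ν (a * b) ≡ ν a + ν b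
  ν-* {a} {b} 0<a 0<b with ν-spec 0<a | ν-spec 0<b
  ... | u , a≡ , p∤u | w , b≡ , p∤w = ν-unique ab≡ p∤uw
    where
    ab≡ : a * b ≡ p ^ (ν a + ν b) * (u * w)
    ab≡ = begin
      a * b                               ≡⟨ cong₂ _*_ a≡ b≡ ⟩
      p ^ ν a * u * (p ^ ν b * w)         ≡⟨ lemma (p ^ ν a) (p ^ ν b) u w ⟩
      p ^ ν a * p ^ ν b * (u * w)         ≡⟨ cong (_* (u * w)) (sym (^-distribˡ-+-* p (ν a) (ν b))) ⟩
      p ^ (ν a + ν b) * (u * w)           ∎
      where
      open ≡-Reasoning
      lemma : ∀ x y s t → x * s * (y * t) ≡ x * y * (s * t)
      lemma = solve-∀
    p∤uw : p ∤ u * w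
    p∤uw p∣uw with euclidsLemma u w pp p∣uw
    ... | inj₁ p∣u = p∤u p∣u
    ... | inj₂ p∣w = p∤w p∣w

  ν-∤ : p ∤ n → ν n ≡ 0
  ν-∤ {n} p∤n = ν-unique (sym (*-identityˡ n)) p∤n

  ν-∣ : 0 < n → p ∣ n → 0 < ν n
  ν-∣ {n} 0<n p∣n with ν-spec 0<n
  ... | u , n≡ , p∤u with ν n
  ...   | zero  = contradiction (subst (p ∣_) (trans n≡ (*-identityˡ u)) p∣n) p∤u
  ...   | suc _ = z<s

  ν≤1 : 0 < n → p * p ∤ n → ν n ≤ 1
  ν≤1 {n} 0<n p²∤n with ν-spec 0<n
  ... | u , n≡ , p∤u with ν n
  ...   | zero        = z≤n
  ...   | suc zero    = s≤s z≤n
  ...   | suc (suc k) = contradiction (divides (p ^ k * u) (trans n≡ (lemma p (p ^ k) u))) p²∤n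
    where
    lemma : ∀ a b c → a * (a * b) * c ≡ b * c * (a * a)
    lemma = solve-∀

∣-from-ν : 0 < x → 0 < y → (∀ {r} (pr : Prime r) → Valuation.ν pr x ≤ Valuation.ν pr y) → x ∣ y
∣-from-ν {x} 0<x 0<y ν≤ with factorise x {{>-nonZero 0<x}}
... | record { factors = fs ; isFactorisation = refl ; factorsPrime = fs-prime } =
  product-∣ fs fs-prime 0<x 0<y ν≤
  where
  product-∣ : ∀ fs → All Prime fs → 0 < product fs → 0 < y →
              (∀ {r} (pr : Prime r) → Valuation.ν pr (product fs) ≤ Valuation.ν pr y) → product fs ∣ y
  product-∣ []       _              _   _   _  = 1∣ _
  product-∣ {y} (q ∷ fs) (pq ∷ fs-prime) 0<P 0<y ν≤ = subst (q * product fs ∣_) (sym y≡) (*-monoʳ-∣ q fs∣y′)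
    where
    open Valuation pq using (ν-∣; ν-∤)
    0<q : 0 < q
    0<q = >-nonZero⁻¹ q {{prime⇒nonZero pq}}
    0<fs : 0 < product fs
    0<fs = >-nonZero⁻¹ (product fs) {{m*n≢0⇒n≢0 q {{>-nonZero 0<P}}}}
    q∣y : q ∣ y
    q∣y with q ∣? y
    ... | yes q∣y = q∣y
    ... | no  q∤y = contradiction (≤-trans (ν-∣ 0<P (m∣m*n (product fs))) (≤-trans (ν≤ pq) (≤-reflexive (ν-∤ q∤y)))) λ ()
    y′ : ℕ
    y′ = quotient q∣y
    y≡ : y ≡ q * y′
    y≡ = m∣n⇒n≡m*quotient q∣y
    0<y′ : 0 < y′
    0<y′ = >-nonZero⁻¹ y′ {{m*n≢0⇒n≢0 q {{>-nonZero (subst (0 <_) y≡ 0<y)}}}}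
    fs∣y′ : product fs ∣ y′
    fs∣y′ = product-∣ fs fs-prime 0<fs 0<y′ λ pr → +-cancelˡ-≤ (Valuation.ν pr q) _ _ (subst₂ _≤_
      (Valuation.ν-* pr 0<q 0<fs) (trans (cong (Valuation.ν pr) y≡) (Valuation.ν-* pr 0<q 0<y′)) (ν≤ pr))

-- The order of 2 modulo an odd prime, and lifting the exponent

triangle : ℕ → ℕ
triangle zero    = 0
triangle (suc n) = triangle n + n

triangle-odd : ∀ w → triangle (1 + 2 * w) ≡ (1 + 2 * w) * w
triangle-odd w = *-cancelˡ-≡ _ _ 2 (+-cancelʳ-≡ (1 + 2 * w) _ _ (trans (twice-triangle (1 + 2 * w)) (lemma w)))
  where
  twice-triangle : ∀ n → 2 * triangle n + n ≡ n * n
  twice-triangle zero    = refl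
  twice-triangle (suc n) = trans (step (triangle n) n) (trans (cong (λ z → z + 2 * n + 1) (twice-triangle n)) (square n))
    where
    step : ∀ a n → 2 * (a + n) + suc n ≡ 2 * a + n + 2 * n + 1
    step = solve-∀
    square : ∀ n → n * n + 2 * n + 1 ≡ suc n * suc n
    square = solve-∀
  lemma : ∀ w → (1 + 2 * w) * (1 + 2 * w) ≡ 2 * ((1 + 2 * w) * w) + (1 + 2 * w)
  lemma = solve-∀

geometric-1+-mod : ∀ c n → ∃ λ k → geometric (1 + c) n ≡ n + c * k
geometric-1+-mod c zero    = 0 , sym (*-zeroʳ c)
geometric-1+-mod c (suc n) with geometric-1+-mod c n
... | k , eq = n + (1 + c) * k , trans (cong (λ z → 1 + (1 + c) * z) eq) (lemma c n k)
  where
  lemma : ∀ c n k → 1 + (1 + c) * (n + c * k) ≡ suc n + c * (n + (1 + c) * k)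
  lemma = solve-∀

geometric-1+-mod² : ∀ c n → ∃ λ k → geometric (1 + c) n ≡ n + c * triangle n + c * c * k
geometric-1+-mod² c zero    = 0 , lemma c
  where
  lemma : ∀ c → 0 ≡ 0 + c * 0 + c * c * 0
  lemma = solve-∀
geometric-1+-mod² c (suc n) with geometric-1+-mod² c n
... | k , eq = triangle n + (1 + c) * k , trans (cong (λ z → 1 + (1 + c) * z) eq) (lemma c n (triangle n) k)
  where
  lemma : ∀ c n t k → 1 + (1 + c) * (n + c * t + c * c * k) ≡ suc n + c * (t + n) + c * c * (t + (1 + c) * k)
  lemma = solve-∀

∤geometric : p ∤ n → p ∤ geometric (1 + p * t) n
∤geometric {p} {n} {t} p∤n p∣geo with geometric-1+-mod (p * t) n
... | k , eq = p∤n (∣m+n∣m⇒∣n (subst (p ∣_) (trans eq (+-comm n _)) p∣geo) (∣m⇒∣m*n k (m∣m*n t)))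

square∤geometric : 1 < p → p ≡ 1 + 2 * w → p * p ∤ geometric (1 + p * t) p
square∤geometric {p} {w} {t} 1<p p≡ p²∣geo with geometric-1+-mod² (p * t) p
... | k , eq = <-irrefl refl (<-≤-trans (m<m*n p p {{>-nonZero (<-trans z<s 1<p)}} 1<p) (∣⇒≤ {{>-nonZero (<-trans z<s 1<p)}} p²∣p))
  where
  geo≡ : geometric (1 + p * t) p ≡ p + p * p * (t * w + t * t * k)
  geo≡ = begin
    geometric (1 + p * t) p                           ≡⟨ eq ⟩
    p + p * t * triangle p + p * t * (p * t) * k      ≡⟨ cong (λ z → p + p * t * triangle z + p * t * (p * t) * k) p≡ ⟩
    p + p * t * triangle (1 + 2 * w) + p * t * (p * t) * k  ≡⟨ cong (λ z → p + p * t * z + p * t * (p * t) * k) (triangle-odd w) ⟩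
    p + p * t * ((1 + 2 * w) * w) + p * t * (p * t) * k    ≡⟨ cong (λ z → p + p * t * (z * w) + p * t * (p * t) * k) (sym p≡) ⟩
    p + p * t * (p * w) + p * t * (p * t) * k         ≡⟨ lemma p t w k ⟩
    p + p * p * (t * w + t * t * k)                   ∎
    where
    open ≡-Reasoning
    lemma : ∀ p t w k → p + p * t * (p * w) + p * t * (p * t) * k ≡ p + p * p * (t * w + t * t * k)
    lemma = solve-∀
  p²∣p : p * p ∣ p
  p²∣p = ∣m+n∣m⇒∣n (subst (p * p ∣_) (trans geo≡ (+-comm p _)) p²∣geo) (m∣m*n (t * w + t * t * k))

least-witness : {P : ℕ → Set} → Decidable P → P n → ∃ λ k → P k × (∀ {j} → j < k → ¬ P j)
least-witness {P = P} P? = <-rec (λ n → P n → Least) step _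
  where
  Least : Set
  Least = ∃ λ k → P k × (∀ {j} → j < k → ¬ P j)
  step : ∀ n → (∀ {m} → m < n → P m → Least) → P n → Least
  step n rec Pn with anyUpTo? P? n
  ... | yes (j , j<n , Pj) = rec j<n Pj
  ... | no ∄j              = n , Pn , λ j<n Pj → ∄j (_ , j<n , Pj)

Primitive : ℕ → ℕ → Set
Primitive p d = p ∣ mersenne d × (∀ {k} → k < d → 0 < k → p ∤ mersenne k)

primitive? : ∀ p d → Dec (Primitive p d)
primitive? p d = p ∣? mersenne d ×-dec allUpTo? (λ k → 0 <? k →-dec ¬? (p ∣? mersenne k)) d

primitive-unique : Primitive p a → Primitive p b → 0 < a → 0 < b → a ≡ b
primitive-unique {a = a} {b = b} (p∣Ma , minimal-a) (p∣Mb , minimal-b) 0<a 0<b with <-cmp a b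
... | tri< a<b _ _ = contradiction p∣Ma (minimal-b a<b 0<a)
... | tri≈ _ a≡b _ = a≡b
... | tri> _ _ b<a = contradiction p∣Mb (minimal-a b<a 0<b)

module OddPrime (pp : Prime p) (p≢2 : p ≢ 2) where

  ∣mersenne-+⁻ : p ∣ mersenne a → p ∣ mersenne (a + b) → p ∣ mersenne b
  ∣mersenne-+⁻ {a} {b} p∣Ma p∣Ma+b
    with euclidsLemma (2 ^ a) (mersenne b) pp
           (∣m+n∣m⇒∣n (subst (p ∣_) (trans (mersenne-+ a b) (+-comm _ (mersenne a))) p∣Ma+b) p∣Ma)
  ... | inj₁ p∣2^a = contradiction (prime∣2^⇒≡2 {a = a} pp p∣2^a) p≢2
  ... | inj₂ p∣Mb  = p∣Mb

  primitive-exists : 0 < n → p ∣ mersenne n → ∃ λ e → 0 < e × Primitive p e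
  primitive-exists 0<n p∣Mn
    with least-witness (λ k → 0 <? k ×-dec p ∣? mersenne k) (0<n , p∣Mn)
  ... | e , (0<e , p∣Me) , below = e , 0<e , p∣Me , λ k<e 0<k p∣Mk → below k<e (0<k , p∣Mk)

  primitive∣ : 0 < e → Primitive p e → p ∣ mersenne x → e ∣ x
  primitive∣ {e} {x} 0<e (p∣Me , minimal) p∣Mx = m%n≡0⇒n∣m x e (remainder≡0 (x % e) (m%n<n x e) p∣M[x%e])
    where
    instance
      _ : NonZero e
      _ = >-nonZero 0<e
    x≡ : (x / e) * e + x % e ≡ x
    x≡ = trans (+-comm _ (x % e)) (sym (m≡m%n+[m/n]*n x e))
    p∣M[x%e] : p ∣ mersenne (x % e)
    p∣M[x%e] = ∣mersenne-+⁻ {(x / e) * e} (∣-trans p∣Me (mersenne-∣ (n∣m*n (x / e) {e})))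
                            (subst (λ z → p ∣ mersenne z) (sym x≡) p∣Mx)
    remainder≡0 : ∀ r → r < e → p ∣ mersenne r → r ≡ 0
    remainder≡0 zero    _   _    = refl
    remainder≡0 (suc r) r<e p∣Mr = contradiction p∣Mr (minimal r<e z<s)

  open Valuation pp

  private
    2^≡1+p* : mersenne x ≡ t * p → 2 ^ x ≡ 1 + p * t
    2^≡1+p* {x} {t} Mx≡ = trans (2^≡1+mersenne x) (cong (1 +_) (trans Mx≡ (*-comm t p)))

  ν-mersenne-*-coprime : 0 < x → p ∣ mersenne x → 0 < q → p ∤ q → ν (mersenne (x * q)) ≡ ν (mersenne x)
  ν-mersenne-*-coprime {x} {q} 0<x (divides t Mx≡) 0<q p∤q = begin
    ν (mersenne (x * q))                        ≡⟨ cong ν (mersenne-* x q) ⟩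
    ν (mersenne x * geometric (2 ^ x) q)        ≡⟨ ν-* (mersenne>0 0<x) (geometric>0 0<q) ⟩
    ν (mersenne x) + ν (geometric (2 ^ x) q)    ≡⟨ cong (ν (mersenne x) +_) (ν-∤ p∤geometric) ⟩
    ν (mersenne x) + 0                          ≡⟨ +-identityʳ _ ⟩
    ν (mersenne x)                              ∎
    where
    open ≡-Reasoning
    p∤geometric : p ∤ geometric (2 ^ x) q
    p∤geometric = subst (λ z → p ∤ geometric z q) (sym (2^≡1+p* {x} Mx≡)) (∤geometric {t = t} p∤q)

  ν-mersenne-*-self : 0 < x → p ∣ mersenne x → ν (mersenne (x * p)) ≤ ν (mersenne x) + 1
  ν-mersenne-*-self {x} 0<x (divides t Mx≡) with odd-prime pp p≢2
  ... | w , p≡ = begin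
    ν (mersenne (x * p))                        ≡⟨ cong ν (mersenne-* x p) ⟩
    ν (mersenne x * geometric (2 ^ x) p)        ≡⟨ ν-* (mersenne>0 0<x) (geometric>0 0<p) ⟩
    ν (mersenne x) + ν (geometric (2 ^ x) p)    ≤⟨ +-monoʳ-≤ (ν (mersenne x)) (ν≤1 (geometric>0 0<p) p²∤geometric) ⟩
    ν (mersenne x) + 1                          ∎
    where
    open ≤-Reasoning
    0<p : 0 < p
    0<p = <-trans z<s (prime≥2 pp)
    p²∤geometric : p * p ∤ geometric (2 ^ x) p
    p²∤geometric = subst (λ z → p * p ∤ geometric z p) (sym (2^≡1+p* {x} Mx≡)) (square∤geometric {w = w} {t = t} (prime≥2 pp) p≡)

data DescendingPrimes : List ℕ → Set where
  []   : DescendingPrimes []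
  cons : Prime q → All (_< q) Q → DescendingPrimes Q → DescendingPrimes (q ∷ Q)

descending⇒primes : DescendingPrimes Q → All Prime Q
descending⇒primes []              = []
descending⇒primes (cons pq _ dQ) = pq ∷ descending⇒primes dQ

product>0 : DescendingPrimes Q → 0 < product Q
product>0 dQ = productOfPrimes≥1 (descending⇒primes dQ)

prime∣product⇒∈ : Prime r → DescendingPrimes Q → r ∣ product Q → r ∈ Q
prime∣product⇒∈ pr dQ r∣P = factorisationHasAllPrimeFactors pr r∣P (descending⇒primes dQ)

head∤product : DescendingPrimes (q ∷ Q) → q ∤ product Q
head∤product (cons pq q>Q dQ) q∣P = <-irrefl refl (All.lookup q>Q (prime∣product⇒∈ pq dQ q∣P))

squarefree : DescendingPrimes Q → Prime q → q * q ∤ product Q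
squarefree [] pq q²∣1 = <-irrefl (sym (m*n≡1⇒m≡1 _ _ (∣1⇒≡1 q²∣1))) (prime≥2 pq)
squarefree {r ∷ Q} {q} dQ@(cons pr _ dQ′) pq q²∣rP with q ≟ r
... | yes refl = head∤product dQ (*-cancelˡ-∣ q {{prime⇒nonZero pq}} q²∣rP)
... | no  q≢r  = squarefree dQ′ pq (coprime-divisor (Coprime.sym (prime∤⇒coprime pr r∤q²)) q²∣rP)
  where
  r∤q² : r ∤ q * q
  r∤q² r∣q² with euclidsLemma q q pr r∣q²
  ... | inj₁ r∣q = q≢r (sym (prime∣prime⇒≡ pr pq r∣q))
  ... | inj₂ r∣q = q≢r (sym (prime∣prime⇒≡ pr pq r∣q))

product-∣ : ∀ {d} → DescendingPrimes Q → (∀ {r} → r ∈ Q → r ∣ d) → product Q ∣ d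
product-∣ []                 _   = 1∣ _
product-∣ {q ∷ Q} dQ@(cons pq _ dQ′) Q∣d with product-∣ dQ′ (Q∣d ∘ there)
... | divides t refl = divides t′ (trans (cong (_* product Q) t≡) (*-assoc t′ q (product Q)))
  where
  q∣t : q ∣ t
  q∣t = coprime-divisor (prime∤⇒coprime pq (head∤product dQ)) (subst (q ∣_) (*-comm t (product Q)) (Q∣d (here refl)))
  t′ : ℕ
  t′ = quotient q∣t
  t≡ : t ≡ t′ * q
  t≡ = _∣_.equality q∣t

primeDivisorsUpTo : ℕ → ℕ → List ℕ
primeDivisorsUpTo d zero    = []
primeDivisorsUpTo d (suc k) with prime? (suc k) ×-dec suc k ∣? d
... | yes _ = suc k ∷ primeDivisorsUpTo d k
... | no  _ = primeDivisorsUpTo d k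

primeDivisorsUpTo-≤ : ∀ d k → All (_≤ k) (primeDivisorsUpTo d k)
primeDivisorsUpTo-≤ d zero    = []
primeDivisorsUpTo-≤ d (suc k) with prime? (suc k) ×-dec suc k ∣? d
... | yes _ = ≤-refl ∷ All.map m≤n⇒m≤1+n (primeDivisorsUpTo-≤ d k)
... | no  _ = All.map m≤n⇒m≤1+n (primeDivisorsUpTo-≤ d k)

primeDivisorsUpTo-descending : ∀ d k → DescendingPrimes (primeDivisorsUpTo d k)
primeDivisorsUpTo-descending d zero    = []
primeDivisorsUpTo-descending d (suc k) with prime? (suc k) ×-dec suc k ∣? d
... | yes (pk , _) = cons pk (All.map s≤s (primeDivisorsUpTo-≤ d k)) (primeDivisorsUpTo-descending d k)
... | no  _        = primeDivisorsUpTo-descending d k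

primeDivisorsUpTo-∣ : ∀ d k → r ∈ primeDivisorsUpTo d k → r ∣ d
primeDivisorsUpTo-∣ d (suc k) r∈ with prime? (suc k) ×-dec suc k ∣? d
primeDivisorsUpTo-∣ d (suc k) (here refl) | yes (_ , k∣d) = k∣d
primeDivisorsUpTo-∣ d (suc k) (there r∈)  | yes _         = primeDivisorsUpTo-∣ d k r∈
primeDivisorsUpTo-∣ d (suc k) r∈          | no  _         = primeDivisorsUpTo-∣ d k r∈

primeDivisorsUpTo-complete : ∀ d k → Prime r → r ∣ d → r ≤ k → r ∈ primeDivisorsUpTo d k
primeDivisorsUpTo-complete d zero    pr _   r≤0 = contradiction (≤-trans (prime≥2 pr) r≤0) λ ()
primeDivisorsUpTo-complete {r} d (suc k) pr r∣d r≤1+k with prime? (suc k) ×-dec suc k ∣? d | m≤n⇒m<n∨m≡n r≤1+k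
... | yes _   | inj₁ r<1+k = there (primeDivisorsUpTo-complete d k pr r∣d (s≤s⁻¹ r<1+k))
... | yes _   | inj₂ refl  = here refl
... | no  _   | inj₁ r<1+k = primeDivisorsUpTo-complete d k pr r∣d (s≤s⁻¹ r<1+k)
... | no  r∤d | inj₂ refl  = contradiction (pr , r∣d) r∤d

radical-decomposition : ∀ {d} → 0 < d → ∃₂ λ m Q → DescendingPrimes Q × m * product Q ≡ d × (∀ {r} → Prime r → r ∣ d → r ∈ Q)
radical-decomposition {d} 0<d = quotient P∣d , primes , descending , sym (_∣_.equality P∣d) , complete
  where
  primes : List ℕ
  primes = primeDivisorsUpTo d d
  descending : DescendingPrimes primes
  descending = primeDivisorsUpTo-descending d d
  P∣d : product primes ∣ d
  P∣d = product-∣ descending (primeDivisorsUpTo-∣ d d)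
  complete : Prime r → r ∣ d → r ∈ primes
  complete pr r∣d = primeDivisorsUpTo-complete d d pr r∣d (∣⇒≤ {{>-nonZero 0<d}} r∣d)

-- Signed sums and products over divisors

-- For squarefree P = product Q, Σ⁺ h Q and Σ⁻ h Q sum h y over the divisors y of P with
-- μ (P / y) = 1 and μ (P / y) = -1 respectively; Π⁺ and Π⁻ are the corresponding products.
mutual
  Σ⁺ : (ℕ → ℕ) → List ℕ → ℕ
  Σ⁺ h []      = h 1
  Σ⁺ h (q ∷ Q) = Σ⁺ (h ∘ (q *_)) Q + Σ⁻ h Q

  Σ⁻ : (ℕ → ℕ) → List ℕ → ℕ
  Σ⁻ h []      = 0
  Σ⁻ h (q ∷ Q) = Σ⁻ (h ∘ (q *_)) Q + Σ⁺ h Q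

mutual
  Π⁺ : (ℕ → ℕ) → List ℕ → ℕ
  Π⁺ h []      = h 1
  Π⁺ h (q ∷ Q) = Π⁺ (h ∘ (q *_)) Q * Π⁻ h Q

  Π⁻ : (ℕ → ℕ) → List ℕ → ℕ
  Π⁻ h []      = 1
  Π⁻ h (q ∷ Q) = Π⁻ (h ∘ (q *_)) Q * Π⁺ h Q

Σ-cong : ∀ {h h′} Q → (∀ {y} → y ∣ product Q → h y ≡ h′ y) → Σ⁺ h Q ≡ Σ⁺ h′ Q × Σ⁻ h Q ≡ Σ⁻ h′ Q
Σ-cong []      h≗h′ = h≗h′ (1∣ _) , refl
Σ-cong (q ∷ Q) h≗h′ with Σ-cong Q (h≗h′ ∘ *-monoʳ-∣ q) | Σ-cong Q (h≗h′ ∘ ∣n⇒∣m*n q)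
... | multiples⁺ , multiples⁻ | divisors⁺ , divisors⁻ = cong₂ _+_ multiples⁺ divisors⁻ , cong₂ _+_ multiples⁻ divisors⁺

Σ-vanishing : ∀ {h} Q → (∀ {y} → y ∣ product Q → h y ≡ 0) → Σ⁺ h Q ≡ 0 × Σ⁻ h Q ≡ 0
Σ-vanishing []      h≗0 = h≗0 (1∣ _) , refl
Σ-vanishing (q ∷ Q) h≗0 with Σ-vanishing Q (h≗0 ∘ *-monoʳ-∣ q) | Σ-vanishing Q (h≗0 ∘ ∣n⇒∣m*n q)
... | multiples⁺ , multiples⁻ | divisors⁺ , divisors⁻ = cong₂ _+_ multiples⁺ divisors⁻ , cong₂ _+_ multiples⁻ divisors⁺

Σ-concentrated : ∀ {h} → DescendingPrimes Q → (∀ {y} → y ∣ product Q → y ≢ product Q → h y ≡ 0) →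
                 Σ⁺ h Q ≡ h (product Q) × Σ⁻ h Q ≡ 0
Σ-concentrated [] _ = refl , refl
Σ-concentrated {q ∷ Q} {h} (cons pq _ dQ) h≗0 with Σ-concentrated dQ h≗0ᵐ | Σ-vanishing Q h≗0ᵈ
  where
  instance
    _ : NonZero q
    _ = prime⇒nonZero pq
  h≗0ᵐ : y ∣ product Q → y ≢ product Q → h (q * y) ≡ 0
  h≗0ᵐ y∣P y≢P = h≗0 (*-monoʳ-∣ q y∣P) (y≢P ∘ *-cancelˡ-≡ _ _ q)
  P<qP : product Q < q * product Q
  P<qP = subst (product Q <_) (*-comm (product Q) q) (m<m*n (product Q) q {{>-nonZero (product>0 dQ)}} (prime≥2 pq))
  h≗0ᵈ : y ∣ product Q → h y ≡ 0
  h≗0ᵈ y∣P = h≗0 (∣n⇒∣m*n q y∣P) λ { refl → <⇒≱ P<qP (∣⇒≤ {{>-nonZero (product>0 dQ)}} y∣P) }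
... | multiples⁺ , multiples⁻ | divisors⁺ , divisors⁻ =
  trans (cong₂ _+_ multiples⁺ divisors⁻) (+-identityʳ _) , cong₂ _+_ multiples⁻ divisors⁺

Σ⁺≡Σ⁻ : ∀ {h} → q ∈ Q → (∀ {y} → q * y ∣ product Q → h (q * y) ≡ h y) → Σ⁺ h Q ≡ Σ⁻ h Q
Σ⁺≡Σ⁻ {q} {q ∷ Q} {h} (here refl) h-periodic = begin
  Σ⁺ (h ∘ (q *_)) Q + Σ⁻ h Q  ≡⟨ cong (_+ Σ⁻ h Q) (proj₁ shifted) ⟩
  Σ⁺ h Q + Σ⁻ h Q            ≡⟨ +-comm (Σ⁺ h Q) (Σ⁻ h Q) ⟩
  Σ⁻ h Q + Σ⁺ h Q            ≡⟨ cong (_+ Σ⁺ h Q) (sym (proj₂ shifted)) ⟩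
  Σ⁻ (h ∘ (q *_)) Q + Σ⁺ h Q  ∎
  where
  open ≡-Reasoning
  shifted : Σ⁺ (h ∘ (q *_)) Q ≡ Σ⁺ h Q × Σ⁻ (h ∘ (q *_)) Q ≡ Σ⁻ h Q
  shifted = Σ-cong Q (h-periodic ∘ *-monoʳ-∣ q)
Σ⁺≡Σ⁻ {q} {r ∷ Q} {h} (there q∈Q) h-periodic = cong₂ _+_ multiples (sym divisors)
  where
  commute : ∀ y → r * (q * y) ≡ q * (r * y)
  commute y = trans (sym (*-assoc r q y)) (trans (cong (_* y) (*-comm r q)) (*-assoc q r y))
  multiples : Σ⁺ (h ∘ (r *_)) Q ≡ Σ⁻ (h ∘ (r *_)) Q
  multiples = Σ⁺≡Σ⁻ q∈Q λ {y} qy∣P →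
    trans (cong h (commute y)) (h-periodic (subst (_∣ r * product Q) (commute y) (*-monoʳ-∣ r qy∣P)))
  divisors : Σ⁺ h Q ≡ Σ⁻ h Q
  divisors = Σ⁺≡Σ⁻ q∈Q (h-periodic ∘ ∣n⇒∣m*n r)

Σ⁺≤Σ⁻+1 : ∀ {h} → DescendingPrimes Q → p ∈ Q →
          (∀ {y} → y ∣ product Q → product Q ∤ p * y → h y ≡ 0) →
          (∀ {y} → p * y ≡ product Q → h (product Q) ≤ h y + 1) →
          Σ⁺ h Q ≤ Σ⁻ h Q + 1
Σ⁺≤Σ⁻+1 {p ∷ Q} {p} {h} dQ@(cons pp _ dQ′) (here refl) h≗0 h-step = begin
  Σ⁺ (h ∘ (p *_)) Q + Σ⁻ h Q                ≡⟨ cong₂ _+_ (proj₁ multiples) (proj₂ divisors) ⟩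
  h (p * product Q) + 0                     ≡⟨ +-identityʳ _ ⟩
  h (p * product Q)                         ≤⟨ h-step refl ⟩
  h (product Q) + 1                         ≡⟨ cong (_+ 1) (sym (proj₁ divisors)) ⟩
  Σ⁺ h Q + 1                                ≡⟨ cong (λ z → z + Σ⁺ h Q + 1) (sym (proj₂ multiples)) ⟩
  Σ⁻ (h ∘ (p *_)) Q + Σ⁺ h Q + 1            ∎
  where
  open ≤-Reasoning
  instance
    _ : NonZero p
    _ = prime⇒nonZero pp
  P∣p*⇒P∣ : product Q ∣ p * y → product Q ∣ y
  P∣p*⇒P∣ = coprime-divisor (Coprime.sym (prime∤⇒coprime pp (head∤product dQ)))
  multiples : Σ⁺ (h ∘ (p *_)) Q ≡ h (p * product Q) × Σ⁻ (h ∘ (p *_)) Q ≡ 0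
  multiples = Σ-concentrated dQ′ λ y∣P y≢P → h≗0 (*-monoʳ-∣ p y∣P) λ pP∣ppy →
    y≢P (∣-antisym y∣P (P∣p*⇒P∣ (*-cancelˡ-∣ p pP∣ppy)))
  divisors : Σ⁺ h Q ≡ h (product Q) × Σ⁻ h Q ≡ 0
  divisors = Σ-concentrated dQ′ λ y∣P y≢P →
    h≗0 (∣n⇒∣m*n p y∣P) λ pP∣py → y≢P (∣-antisym y∣P (*-cancelˡ-∣ p pP∣py))
Σ⁺≤Σ⁻+1 {r ∷ Q} {p} {h} dQ@(cons pr r>Q dQ′) (there p∈Q) h≗0 h-step = begin
  Σ⁺ (h ∘ (r *_)) Q + Σ⁻ h Q                ≡⟨ cong (Σ⁺ (h ∘ (r *_)) Q +_) (proj₂ divisors) ⟩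
  Σ⁺ (h ∘ (r *_)) Q + 0                     ≡⟨ +-identityʳ _ ⟩
  Σ⁺ (h ∘ (r *_)) Q                         ≤⟨ multiples ⟩
  Σ⁻ (h ∘ (r *_)) Q + 1                     ≡⟨ cong (_+ 1) (sym (+-identityʳ _)) ⟩
  Σ⁻ (h ∘ (r *_)) Q + 0 + 1                 ≡⟨ cong (λ z → Σ⁻ (h ∘ (r *_)) Q + z + 1) (sym (proj₁ divisors)) ⟩
  Σ⁻ (h ∘ (r *_)) Q + Σ⁺ h Q + 1            ∎
  where
  open ≤-Reasoning
  instance
    _ : NonZero r
    _ = prime⇒nonZero pr
  commute : ∀ y → r * (p * y) ≡ p * (r * y)
  commute y = trans (sym (*-assoc r p y)) (trans (cong (_* y) (*-comm r p)) (*-assoc p r y))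
  r∤p*y : y ∣ product Q → r ∤ p * y
  r∤p*y y∣P r∣py with euclidsLemma p _ pr r∣py
  ... | inj₁ r∣p = <-irrefl (sym (prime∣prime⇒≡ pr (All.lookup (descending⇒primes dQ′) p∈Q) r∣p)) (All.lookup r>Q p∈Q)
  ... | inj₂ r∣y = head∤product dQ (∣-trans r∣y y∣P)
  divisors : Σ⁺ h Q ≡ 0 × Σ⁻ h Q ≡ 0
  divisors = Σ-vanishing Q λ y∣P → h≗0 (∣n⇒∣m*n r y∣P) λ rP∣py → r∤p*y y∣P (∣-trans (m∣m*n _) rP∣py)
  multiples : Σ⁺ (h ∘ (r *_)) Q ≤ Σ⁻ (h ∘ (r *_)) Q + 1
  multiples = Σ⁺≤Σ⁻+1 dQ′ p∈Q
    (λ {y} y∣P P∤py → h≗0 (*-monoʳ-∣ r y∣P) λ rP∣pry → P∤py (*-cancelˡ-∣ r (subst (r * product Q ∣_) (sym (commute y)) rP∣pry)))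
    (λ {y} py≡P → h-step (trans (sym (commute y)) (cong (r *_) py≡P)))

Π>0 : ∀ {g} Q → (∀ {y} → y ∣ product Q → 0 < g y) → 0 < Π⁺ g Q × 0 < Π⁻ g Q
Π>0 []      g>0 = g>0 (1∣ _) , z<s
Π>0 (q ∷ Q) g>0 with Π>0 Q (g>0 ∘ *-monoʳ-∣ q) | Π>0 Q (g>0 ∘ ∣n⇒∣m*n q)
... | multiples⁺ , multiples⁻ | divisors⁺ , divisors⁻ = *-mono-≤ multiples⁺ divisors⁻ , *-mono-≤ multiples⁻ divisors⁺

module _ (pp : Prime p) where
  open Valuation pp

  ν-Π : ∀ {g} Q → (∀ {y} → y ∣ product Q → 0 < g y) → ν (Π⁺ g Q) ≡ Σ⁺ (ν ∘ g) Q × ν (Π⁻ g Q) ≡ Σ⁻ (ν ∘ g) Q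
  ν-Π []      g>0 = refl , ν-∤ (λ p∣1 → <-irrefl (sym (∣1⇒≡1 p∣1)) (prime≥2 pp))
  ν-Π (q ∷ Q) g>0 with Π>0 Q (g>0 ∘ *-monoʳ-∣ q) | Π>0 Q (g>0 ∘ ∣n⇒∣m*n q)
                      | ν-Π Q (g>0 ∘ *-monoʳ-∣ q) | ν-Π Q (g>0 ∘ ∣n⇒∣m*n q)
  ... | Πᵐ⁺>0 , Πᵐ⁻>0 | Πᵈ⁺>0 , Πᵈ⁻>0 | multiples⁺ , multiples⁻ | divisors⁺ , divisors⁻ =
    trans (ν-* Πᵐ⁺>0 Πᵈ⁻>0) (cong₂ _+_ multiples⁺ divisors⁻) , trans (ν-* Πᵐ⁻>0 Πᵈ⁺>0) (cong₂ _+_ multiples⁻ divisors⁺)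

Π-upper : ∀ {g ex} Q → (∀ {y} → y ∣ product Q → g y ≤ 2 ^ ex y) → Π⁺ g Q ≤ 2 ^ Σ⁺ ex Q × Π⁻ g Q ≤ 2 ^ Σ⁻ ex Q
Π-upper []      g≤ = g≤ (1∣ _) , ≤-refl
Π-upper {ex = ex} (q ∷ Q) g≤ with Π-upper {ex = ex ∘ (q *_)} Q (g≤ ∘ *-monoʳ-∣ q) | Π-upper {ex = ex} Q (g≤ ∘ ∣n⇒∣m*n q)
... | multiples⁺ , multiples⁻ | divisors⁺ , divisors⁻ =
  combine (Σ⁺ (ex ∘ (q *_)) Q) (Σ⁻ ex Q) multiples⁺ divisors⁻ , combine (Σ⁻ (ex ∘ (q *_)) Q) (Σ⁺ ex Q) multiples⁻ divisors⁺
  where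
  combine : ∀ a b → x ≤ 2 ^ a → y ≤ 2 ^ b → x * y ≤ 2 ^ (a + b)
  combine a b x≤ y≤ = ≤-trans (*-mono-≤ x≤ y≤) (≤-reflexive (sym (^-distribˡ-+-* 2 a b)))

Π-lower : ∀ {g ex c} Q → (∀ {y} → y ∣ product Q → 2 ^ ex y ≤ g y * 2 ^ c y) →
          2 ^ Σ⁺ ex Q ≤ Π⁺ g Q * 2 ^ Σ⁺ c Q × 2 ^ Σ⁻ ex Q ≤ Π⁻ g Q * 2 ^ Σ⁻ c Q
Π-lower []      ≤g = ≤g (1∣ _) , ≤-refl
Π-lower {g} {ex} {c} (q ∷ Q) ≤g
  with Π-lower {ex = ex ∘ (q *_)} {c ∘ (q *_)} Q (≤g ∘ *-monoʳ-∣ q) | Π-lower {ex = ex} {c} Q (≤g ∘ ∣n⇒∣m*n q)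
... | multiples⁺ , multiples⁻ | divisors⁺ , divisors⁻ =
  combine (Σ⁺ (ex ∘ (q *_)) Q) (Σ⁻ ex Q) (Π⁺ (g ∘ (q *_)) Q) (Π⁻ g Q) (Σ⁺ (c ∘ (q *_)) Q) (Σ⁻ c Q) multiples⁺ divisors⁻ ,
  combine (Σ⁻ (ex ∘ (q *_)) Q) (Σ⁺ ex Q) (Π⁻ (g ∘ (q *_)) Q) (Π⁺ g Q) (Σ⁻ (c ∘ (q *_)) Q) (Σ⁺ c Q) multiples⁻ divisors⁺
  where
  combine : ∀ a b x y u w → 2 ^ a ≤ x * 2 ^ u → 2 ^ b ≤ y * 2 ^ w → 2 ^ (a + b) ≤ x * y * 2 ^ (u + w)
  combine a b x y u w ≤x ≤y = begin
    2 ^ (a + b)                  ≡⟨ ^-distribˡ-+-* 2 a b ⟩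
    2 ^ a * 2 ^ b                ≤⟨ *-mono-≤ ≤x ≤y ⟩
    x * 2 ^ u * (y * 2 ^ w)      ≡⟨ lemma x y (2 ^ u) (2 ^ w) ⟩
    x * y * (2 ^ u * 2 ^ w)      ≡⟨ cong (x * y *_) (sym (^-distribˡ-+-* 2 u w)) ⟩
    x * y * 2 ^ (u + w)          ∎
    where
    open ≤-Reasoning
    lemma : ∀ x y s t → x * s * (y * t) ≡ x * y * (s * t)
    lemma = solve-∀

totient : List ℕ → ℕ
totient []      = 1
totient (q ∷ Q) = (q ∸ 1) * totient Q

Σ-linear : ∀ m → DescendingPrimes Q → Σ⁺ (m *_) Q ≡ Σ⁻ (m *_) Q + m * totient Q
Σ-linear m []                   = refl
Σ-linear {q ∷ Q} m (cons pq _ dQ) = begin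
  Σ⁺ (λ y → m * (q * y)) Q + Σ⁻ (m *_) Q                  ≡⟨ cong (_+ Σ⁻ (m *_) Q) (proj₁ reassociate) ⟩
  Σ⁺ ((m * q) *_) Q + Σ⁻ (m *_) Q                         ≡⟨ cong (_+ Σ⁻ (m *_) Q) (Σ-linear (m * q) dQ) ⟩
  Σ⁻ ((m * q) *_) Q + m * q * totient Q + Σ⁻ (m *_) Q     ≡⟨ cong (λ z → Σ⁻ ((m * q) *_) Q + m * z * totient Q + Σ⁻ (m *_) Q) q≡ ⟩
  Σ⁻ ((m * q) *_) Q + m * (1 + (q ∸ 1)) * totient Q + Σ⁻ (m *_) Q
    ≡⟨ lemma (Σ⁻ ((m * q) *_) Q) (Σ⁻ (m *_) Q) m (q ∸ 1) (totient Q) ⟩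
  Σ⁻ ((m * q) *_) Q + (Σ⁻ (m *_) Q + m * totient Q) + m * ((q ∸ 1) * totient Q)
    ≡⟨ cong₂ (λ a b → a + b + m * ((q ∸ 1) * totient Q)) (sym (proj₂ reassociate)) (sym (Σ-linear m dQ)) ⟩
  Σ⁻ (λ y → m * (q * y)) Q + Σ⁺ (m *_) Q + m * ((q ∸ 1) * totient Q) ∎
  where
  open ≡-Reasoning
  reassociate : Σ⁺ (λ y → m * (q * y)) Q ≡ Σ⁺ ((m * q) *_) Q × Σ⁻ (λ y → m * (q * y)) Q ≡ Σ⁻ ((m * q) *_) Q
  reassociate = Σ-cong Q λ {y} _ → sym (*-assoc m q y)
  q≡ : q ≡ 1 + (q ∸ 1)
  q≡ = sym (m+[n∸m]≡n (<-trans z<s (prime≥2 pq)))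
  lemma : ∀ a b m k t → a + m * (1 + k) * t + b ≡ a + (b + m * t) + m * (k * t)
  lemma = solve-∀

-- Bang's theorem

-- Large m Q forces Π⁺ g Q > product Q * Π⁻ g Q for g y = 2 ^ (m * y) - 1.
Large : ℕ → List ℕ → Set
Large m Q = product Q * 2 ^ Σ⁺ (λ _ → 1) Q < 2 ^ (m * totient Q)

module NoPrimitivePrime
  {m : ℕ} {Q : List ℕ} (dQ : DescendingPrimes Q) (0<m : 0 < m)
  (complete : ∀ {r} → Prime r → r ∣ m * product Q → r ∈ Q)
  (no-primitive : ∀ {p} → Prime p → ¬ Primitive p (m * product Q))
  where

  P d : ℕ
  P = product Q
  d = m * P

  g : ℕ → ℕ
  g y = mersenne (m * y)

  0<P : 0 < P
  0<P = product>0 dQ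

  0<d : 0 < d
  0<d = *-mono-≤ 0<m 0<P

  0<m*y : y ∣ P → 0 < m * y
  0<m*y y∣P = *-mono-≤ 0<m (∣⇒>0 0<P y∣P)

  module WithOrder {p e} (pp : Prime p) (p≢2 : p ≢ 2) (0<e : 0 < e) (e-order : Primitive p e) (e∣d : e ∣ d) where
    open Valuation pp
    open OddPrime pp p≢2

    instance
      _ : NonZero p
      _ = prime⇒nonZero pp

    h : ℕ → ℕ
    h = ν ∘ g

    p∣g⇒e∣ : p ∣ g y → e ∣ m * y
    p∣g⇒e∣ = primitive∣ 0<e e-order

    e∣⇒p∣g : e ∣ m * y → p ∣ g y
    e∣⇒p∣g = ∣-trans (proj₁ e-order) ∘ mersenne-∣

    -- Since q ∤ P / (q y), the order e divides m q y only if it divides m y, and then lifting the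
    -- exponent by q ≠ p keeps the valuation: h is invariant under y ↦ q y.
    paired : q ∈ Q → q ≢ p → q * e ∣ d → Σ⁺ h Q ≡ Σ⁻ h Q
    paired {q} q∈Q q≢p qe∣d = Σ⁺≡Σ⁻ q∈Q h-periodic
      where
      pq : Prime q
      pq = All.lookup (descending⇒primes dQ) q∈Q
      instance
        _ : NonZero q
        _ = prime⇒nonZero pq
      p∤q : p ∤ q
      p∤q p∣q = q≢p (sym (prime∣prime⇒≡ pp pq p∣q))
      e∣m*y : q * y ∣ P → e ∣ m * (q * y) → e ∣ m * y
      e∣m*y {y} (divides z P≡) e∣mqy = coprime-factors (prime∤⇒coprime pq q∤z) (e∣q*my , e∣z*my)
        where
        q∤z : q ∤ z
        q∤z q∣z = squarefree dQ pq (subst (q * q ∣_) (sym P≡) (*-pres-∣ q∣z (m∣m*n y)))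
        e∣q*my : e ∣ q * (m * y)
        e∣q*my = subst (e ∣_) (lemma₁ m q y) e∣mqy
          where
          lemma₁ : ∀ m q y → m * (q * y) ≡ q * (m * y)
          lemma₁ = solve-∀
        e∣z*my : e ∣ z * (m * y)
        e∣z*my = *-cancelˡ-∣ q (subst (q * e ∣_) (trans (cong (m *_) P≡) (lemma₂ m z q y)) qe∣d)
          where
          lemma₂ : ∀ m z q y → m * (z * (q * y)) ≡ q * (z * (m * y))
          lemma₂ = solve-∀
      h-periodic : q * y ∣ P → h (q * y) ≡ h y
      h-periodic {y} qy∣P with p ∣? g y
      ... | yes p∣gy = trans (cong (ν ∘ mersenne) (sym (lemma m q y)))
                             (ν-mersenne-*-coprime (0<m*y (∣-trans (n∣m*n q) qy∣P)) p∣gy (>-nonZero⁻¹ q) p∤q)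
        where
        lemma : ∀ m q y → m * y * q ≡ m * (q * y)
        lemma = solve-∀
      ... | no  p∤gy = trans (ν-∤ (p∤gy ∘ e∣⇒p∣g ∘ e∣m*y qy∣P ∘ p∣g⇒e∣)) (sym (ν-∤ p∤gy))

    -- If no prime q ≠ p has q e ∣ d, then h vanishes except at P and P / p, and lifting the exponent
    -- by p raises the valuation by at most 1.
    concentrated : p ∈ Q → p * e ∣ d → (∀ {q} → q ∈ Q → q ≢ p → q * e ∤ d) → Σ⁺ h Q ≤ Σ⁻ h Q + 1
    concentrated p∈Q pe∣d unpaired = Σ⁺≤Σ⁻+1 dQ p∈Q h≗0 h-step
      where
      h≗0 : y ∣ P → P ∤ p * y → h y ≡ 0
      h≗0 {y} (divides z P≡zy) P∤py with ∃prime∣-≢ (n≢0∧n≢1⇒n≥2 z≢0 z≢1) z≢p p²∤z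
        where
        z≢0 : z ≢ 0
        z≢0 refl = <-irrefl (sym P≡zy) 0<P
        z≢1 : z ≢ 1
        z≢1 refl = P∤py (∣-trans (∣-reflexive (trans P≡zy (*-identityˡ y))) (n∣m*n p))
        z≢p : z ≢ p
        z≢p refl = P∤py (∣-reflexive P≡zy)
        p²∤z : p * p ∤ z
        p²∤z p²∣z = squarefree dQ pp (∣-trans p²∣z (divides y (trans P≡zy (*-comm z y))))
      ... | q , pq , q∣z , q≢p = ν-∤ λ p∣gy → unpaired q∈Q q≢p (∣-trans (*-monoʳ-∣ q (p∣g⇒e∣ p∣gy)) q*my∣d)
        where
        q∈Q : q ∈ Q
        q∈Q = prime∣product⇒∈ pq dQ (∣-trans q∣z (divides y (trans P≡zy (*-comm z y))))
        q*my∣d : q * (m * y) ∣ d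
        q*my∣d = subst (q * (m * y) ∣_) (trans (lemma z m y) (cong (m *_) (sym P≡zy))) (*-monoˡ-∣ (m * y) q∣z)
          where
          lemma : ∀ z m y → z * (m * y) ≡ m * (z * y)
          lemma = solve-∀
      h-step : p * y ≡ P → h P ≤ h y + 1
      h-step {y} py≡P = subst (λ x → ν (mersenne x) ≤ h y + 1) m*y*p≡d (ν-mersenne-*-self (0<m*y y∣P) p∣gy)
        where
        y∣P : y ∣ P
        y∣P = divides p (sym py≡P)
        m*y*p≡d : m * y * p ≡ d
        m*y*p≡d = trans (trans (*-assoc m y p) (cong (m *_) (*-comm y p))) (cong (m *_) py≡P)
        p∣gy : p ∣ g y
        p∣gy = e∣⇒p∣g (*-cancelˡ-∣ p (subst (p * e ∣_) d≡ pe∣d))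
          where
          d≡ : d ≡ p * (m * y)
          d≡ = trans (cong (m *_) (sym py≡P)) (trans (sym (*-assoc m p y)) (trans (cong (_* y) (*-comm m p)) (*-assoc p m y)))

    ∃q*e∣d : ∃ λ q → q ∈ Q × q * e ∣ d
    ∃q*e∣d = from-cofactor {quotient e∣d} (_∣_.equality e∣d)
      where
      from-cofactor : d ≡ t * e → ∃ λ q → q ∈ Q × q * e ∣ d
      from-cofactor {t} d≡te with ∃prime∣ (n≢0∧n≢1⇒n≥2 t≢0 t≢1)
        where
        t≢0 : t ≢ 0
        t≢0 refl = <-irrefl (sym d≡te) 0<d
        t≢1 : t ≢ 1
        t≢1 refl = no-primitive pp (subst (Primitive p) (sym (trans d≡te (*-identityˡ e))) e-order)
      ... | q , pq , q∣t = q , complete pq (subst (q ∣_) (sym d≡te) (∣m⇒∣m*n e q∣t)) ,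
                               subst (q * e ∣_) (sym d≡te) (*-monoˡ-∣ e q∣t)

    unpaired⇒p∈Q : (∀ {q} → q ∈ Q → q ≢ p → q * e ∤ d) → p ∈ Q × p * e ∣ d
    unpaired⇒p∈Q unpaired with ∃q*e∣d
    ... | q , q∈Q , qe∣d with q ≟ p
    ...   | yes refl = q∈Q , qe∣d
    ...   | no  q≢p  = contradiction qe∣d (unpaired q∈Q q≢p)

    Σ⁺≤Σ⁻+ν-P : Σ⁺ h Q ≤ Σ⁻ h Q + ν P
    Σ⁺≤Σ⁻+ν-P with any? (λ q → ¬? (q ≟ p) ×-dec q * e ∣? d) Q
    ... | yes ∃q with find ∃q
    ...   | q , q∈Q , q≢p , qe∣d = ≤-trans (≤-reflexive (paired q∈Q q≢p qe∣d)) (m≤m+n _ _)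
    Σ⁺≤Σ⁻+ν-P | no ∄q = ≤-trans (concentrated p∈Q pe∣d unpaired) (+-monoʳ-≤ _ (ν-∣ 0<P (∈⇒∣product p∈Q)))
      where
      unpaired : q ∈ Q → q ≢ p → q * e ∤ d
      unpaired q∈Q q≢p qe∣d = ∄q (lose q∈Q (q≢p , qe∣d))
      p∈Q : p ∈ Q
      p∈Q = proj₁ (unpaired⇒p∈Q unpaired)
      pe∣d : p * e ∣ d
      pe∣d = proj₂ (unpaired⇒p∈Q unpaired)

  ν-Π⁺≤ν-P*Π⁻ : (pp : Prime p) → let open Valuation pp in ν (Π⁺ g Q) ≤ ν (P * Π⁻ g Q)
  ν-Π⁺≤ν-P*Π⁻ {p} pp = begin
    ν (Π⁺ g Q)               ≡⟨ proj₁ (ν-Π pp Q g>0) ⟩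
    Σ⁺ (ν ∘ g) Q             ≤⟨ Σ⁺≤Σ⁻+ν-P ⟩
    Σ⁻ (ν ∘ g) Q + ν P       ≡⟨ cong (_+ ν P) (sym (proj₂ (ν-Π pp Q g>0))) ⟩
    ν (Π⁻ g Q) + ν P         ≡⟨ +-comm _ (ν P) ⟩
    ν P + ν (Π⁻ g Q)         ≡⟨ sym (ν-* 0<P (proj₂ (Π>0 Q g>0))) ⟩
    ν (P * Π⁻ g Q)           ∎
    where
    open ≤-Reasoning
    open Valuation pp
    g>0 : y ∣ P → 0 < g y
    g>0 = mersenne>0 ∘ 0<m*y
    vanishing : (∀ {y} → y ∣ P → p ∤ g y) → Σ⁺ (ν ∘ g) Q ≤ Σ⁻ (ν ∘ g) Q + ν P
    vanishing p∤g = ≤-trans (≤-reflexive (proj₁ (Σ-vanishing Q (ν-∤ ∘ p∤g)))) z≤n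
    Σ⁺≤Σ⁻+ν-P : Σ⁺ (ν ∘ g) Q ≤ Σ⁻ (ν ∘ g) Q + ν P
    Σ⁺≤Σ⁻+ν-P with p ≟ 2 | p ∣? mersenne d
    ... | yes refl | _        = vanishing (2∤mersenne ∘ 0<m*y)
    ... | no  _    | no p∤Md  = vanishing λ y∣P p∣gy → p∤Md (∣-trans p∣gy (mersenne-∣ (*-monoʳ-∣ m y∣P)))
    ... | no  p≢2  | yes p∣Md with OddPrime.primitive-exists pp p≢2 0<d p∣Md
    ...   | e , 0<e , e-order = WithOrder.Σ⁺≤Σ⁻+ν-P pp p≢2 0<e e-order (OddPrime.primitive∣ pp p≢2 0<e e-order p∣Md)

  ¬large : ¬ Large m Q
  ¬large large = <⇒≱ P*B<A (∣⇒≤ {{>-nonZero (*-mono-≤ 0<P 0<B)}} A∣P*B)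
    where
    A B N : ℕ
    A = Π⁺ g Q
    B = Π⁻ g Q
    N = Σ⁺ (λ _ → 1) Q
    0<A : 0 < A
    0<A = proj₁ (Π>0 Q (mersenne>0 ∘ 0<m*y))
    0<B : 0 < B
    0<B = proj₂ (Π>0 Q (mersenne>0 ∘ 0<m*y))
    A∣P*B : A ∣ P * B
    A∣P*B = ∣-from-ν 0<A (*-mono-≤ 0<P 0<B) ν-Π⁺≤ν-P*Π⁻
    2^≤2*g : y ∣ P → 2 ^ (m * y) ≤ g y * 2 ^ 1
    2^≤2*g {y} y∣P = begin
      2 ^ (m * y)              ≡⟨ 2^≡1+mersenne (m * y) ⟩
      1 + g y                  ≤⟨ +-monoˡ-≤ (g y) (mersenne>0 (0<m*y y∣P)) ⟩
      g y + g y                ≡⟨ cong (g y +_) (sym (+-identityʳ (g y))) ⟩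
      2 * g y                  ≡⟨ *-comm 2 (g y) ⟩
      g y * 2 ^ 1              ∎
      where open ≤-Reasoning
    P*B<A : P * B < A
    P*B<A = *-cancelʳ-< (2 ^ N) (P * B) A (begin-strict
      P * B * 2 ^ N                         ≡⟨ lemma P B (2 ^ N) ⟩
      B * (P * 2 ^ N)                       ≤⟨ *-monoˡ-≤ (P * 2 ^ N) (proj₂ (Π-upper Q λ {y} _ → m∸n≤m (2 ^ (m * y)) 1)) ⟩
      2 ^ Σ⁻ (m *_) Q * (P * 2 ^ N)         <⟨ *-monoʳ-< (2 ^ Σ⁻ (m *_) Q) {{m^n≢0 2 (Σ⁻ (m *_) Q)}} large ⟩
      2 ^ Σ⁻ (m *_) Q * 2 ^ (m * totient Q) ≡⟨ sym (^-distribˡ-+-* 2 (Σ⁻ (m *_) Q) (m * totient Q)) ⟩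
      2 ^ (Σ⁻ (m *_) Q + m * totient Q)     ≡⟨ cong (2 ^_) (sym (Σ-linear m dQ)) ⟩
      2 ^ Σ⁺ (m *_) Q                       ≤⟨ proj₁ (Π-lower {ex = m *_} {λ _ → 1} Q 2^≤2*g) ⟩
      A * 2 ^ N                             ∎)
      where
      open ≤-Reasoning
      lemma : ∀ p b n → p * b * n ≡ b * (p * n)
      lemma = solve-∀

linear<exponential : ∀ {c s r₀ r} → 0 < s → 0 < r₀ → c * r₀ < 2 ^ (s * (r₀ ∸ 1)) → r₀ ≤ r → c * r < 2 ^ (s * (r ∸ 1))
linear<exponential {c} {s} {suc a} {r} 0<s _ base r₀≤r =
  subst (λ r → c * r < 2 ^ (s * (r ∸ 1))) (m+[n∸m]≡n r₀≤r) (from-base (r ∸ suc a))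
  where
  step : ∀ r → c * suc r < 2 ^ (s * r) → c * suc (suc r) < 2 ^ (s * suc r)
  step r c*[1+r]< = begin-strict
    c * suc (suc r)                   ≡⟨ *-suc c (suc r) ⟩
    c + c * suc r                     <⟨ +-mono-≤-< (≤-trans (m≤m*n c (suc r)) (<⇒≤ c*[1+r]<)) c*[1+r]< ⟩
    2 ^ (s * r) + 2 ^ (s * r)         ≡⟨ cong (2 ^ (s * r) +_) (sym (+-identityʳ _)) ⟩
    2 ^ suc (s * r)                   ≤⟨ ^-monoʳ-≤ 2 (+-monoˡ-≤ (s * r) 0<s) ⟩
    2 ^ (s + s * r)                   ≡⟨ cong (2 ^_) (sym (*-suc s r)) ⟩
    2 ^ (s * suc r)                   ∎
    where open ≤-Reasoning
  from-base : ∀ k → c * suc (a + k) < 2 ^ (s * (a + k))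
  from-base zero    = subst (λ x → c * suc x < 2 ^ (s * x)) (sym (+-identityʳ a)) base
  from-base (suc k) = subst (λ x → c * suc x < 2 ^ (s * x)) (sym (+-suc a k)) (step (a + k) (from-base k))

totient>0 : DescendingPrimes Q → 0 < totient Q
totient>0 []             = z<s
totient>0 (cons pq _ dQ) = *-mono-≤ (∸-monoˡ-≤ 1 (prime≥2 pq)) (totient>0 dQ)

large-head-mono : DescendingPrimes Q → Large 1 (r ∷ Q) → 0 < r → r ≤ t → Large 1 (t ∷ Q)
large-head-mono {Q} {r} {t} dQ large 0<r r≤t =
  subst₂ _<_ (sym (lhs≡ t)) (cong (2 ^_) (sym (rhs≡ t)))
    (linear<exponential {c = product Q * 2 ^ N} (totient>0 dQ) 0<r (subst₂ _<_ (lhs≡ r) (cong (2 ^_) (rhs≡ r)) large) r≤t)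
  where
  N : ℕ
  N = Σ⁺ (λ _ → 1) Q + Σ⁻ (λ _ → 1) Q
  lhs≡ : ∀ x → x * product Q * 2 ^ N ≡ product Q * 2 ^ N * x
  lhs≡ x = lemma x (product Q) (2 ^ N)
    where
    lemma : ∀ x p n → x * p * n ≡ p * n * x
    lemma = solve-∀
  rhs≡ : ∀ x → 1 * ((x ∸ 1) * totient Q) ≡ totient Q * (x ∸ 1)
  rhs≡ x = trans (*-identityˡ _) (*-comm (x ∸ 1) (totient Q))

large-cons-5 : DescendingPrimes (q ∷ Q) → Large 1 (q ∷ Q) → Large 1 (5 ∷ q ∷ Q)
large-cons-5 {q} {Q} dQ@(cons pq _ dQ′) large = begin-strict
  5 * P * 2 ^ (N + N⁻)         ≡⟨ cong (λ n → 5 * P * 2 ^ (N + n)) N⁻≡N ⟩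
  5 * P * 2 ^ (N + N)          ≡⟨ cong (5 * P *_) (^-distribˡ-+-* 2 N N) ⟩
  5 * P * (2 ^ N * 2 ^ N)      ≡⟨ lemma₁ P (2 ^ N) ⟩
  5 * (X * 2 ^ N)              ≤⟨ *-monoʳ-≤ 5 (*-monoʳ-≤ X 2^N≤X) ⟩
  5 * (X * X)                  <⟨ *-monoʳ-< 5 (*-mono-< X<Y X<Y) ⟩
  5 * (Y * Y)                  ≤⟨ *-monoˡ-≤ (Y * Y) (≤-trans (m≤m+n 5 4) (*-mono-≤ 3≤Y 3≤Y)) ⟩
  Y * Y * (Y * Y)              ≡⟨ 2^4φ ⟩
  2 ^ (1 * (4 * totient (q ∷ Q))) ∎
  where
  open ≤-Reasoning
  P N N⁻ X Y : ℕ
  P  = product (q ∷ Q)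
  N  = Σ⁺ (λ _ → 1) (q ∷ Q)
  N⁻ = Σ⁻ (λ _ → 1) (q ∷ Q)
  X  = P * 2 ^ N
  Y  = 2 ^ totient (q ∷ Q)
  N⁻≡N : N⁻ ≡ N
  N⁻≡N = sym (Σ⁺≡Σ⁻ {q = q} {Q = q ∷ Q} {h = λ _ → 1} (here refl) λ _ → refl)
  X<Y : X < Y
  X<Y = subst (λ e → X < 2 ^ e) (*-identityˡ (totient (q ∷ Q))) large
  2^N≤X : 2 ^ N ≤ X
  2^N≤X = m≤n*m (2 ^ N) P {{>-nonZero (product>0 dQ)}}
  3≤Y : 3 ≤ Y
  3≤Y = ≤-<-trans (≤-trans (≤-trans (prime≥2 pq) (m≤m*n q (product Q) {{>-nonZero (product>0 dQ′)}})) (m≤m*n P (2 ^ N) {{m^n≢0 2 N}})) X<Y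
  lemma₁ : ∀ p n → 5 * p * (n * n) ≡ 5 * (p * n * n)
  lemma₁ = solve-∀
  2^4φ : Y * Y * (Y * Y) ≡ 2 ^ (1 * (4 * totient (q ∷ Q)))
  2^4φ = trans (sym (cong₂ _*_ (^-distribˡ-+-* 2 φ φ) (^-distribˡ-+-* 2 φ φ)))
        (trans (sym (^-distribˡ-+-* 2 (φ + φ) (φ + φ))) (cong (2 ^_) (lemma₂ φ)))
    where
    φ : ℕ
    φ = totient (q ∷ Q)
    lemma₂ : ∀ f → f + f + (f + f) ≡ 1 * (4 * f)
    lemma₂ = solve-∀

descendingPrimesBelow : ℕ → List (List ℕ)
descendingPrimesBelow zero    = [] ∷ []
descendingPrimesBelow (suc k) with prime? k
... | yes _ = map (k ∷_) (descendingPrimesBelow k) ++ descendingPrimesBelow k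
... | no  _ = descendingPrimesBelow k

descendingPrimesBelow-suc : ∀ k → Q ∈ descendingPrimesBelow k → Q ∈ descendingPrimesBelow (suc k)
descendingPrimesBelow-suc k Q∈ with prime? k
... | yes _ = ∈-++⁺ʳ _ Q∈
... | no  _ = Q∈

∈-descendingPrimesBelow : ∀ k → DescendingPrimes Q → All (_< k) Q → Q ∈ descendingPrimesBelow k
∈-descendingPrimesBelow zero    []  []  = here refl
∈-descendingPrimesBelow (suc k) []  []  = descendingPrimesBelow-suc k (∈-descendingPrimesBelow k [] [])
∈-descendingPrimesBelow (suc k) dQ@(cons {q} pq q>Q dQ′) (q<1+k ∷ _) with m≤n⇒m<n∨m≡n (s≤s⁻¹ q<1+k)
... | inj₁ q<k  = descendingPrimesBelow-suc k (∈-descendingPrimesBelow k dQ (q<k ∷ All.map (λ s<q → <-trans s<q q<k) q>Q))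
... | inj₂ refl with prime? q
...   | yes _   = ∈-++⁺ˡ (∈-map⁺ (q ∷_) (∈-descendingPrimesBelow q dQ′ q>Q))
...   | no  ¬pq = contradiction pq ¬pq

large? : ∀ m Q → Dec (Large m Q)
large? m Q = _ <? _

large-mono : t ≤ m → Large t Q → Large m Q
large-mono {Q = Q} t≤m large = <-≤-trans large (^-monoʳ-≤ 2 (*-monoˡ-≤ (totient Q) t≤m))

exceptional-lists : List (List ℕ)
exceptional-lists = (2 ∷ []) ∷ (3 ∷ []) ∷ (3 ∷ 2 ∷ []) ∷ (5 ∷ 2 ∷ []) ∷ (5 ∷ 3 ∷ 2 ∷ []) ∷ []

exceptional : List ℕ
exceptional = 2 ∷ 3 ∷ 4 ∷ 6 ∷ 10 ∷ 12 ∷ 30 ∷ []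

below-7-classified : All (λ Q → Q ≡ [] ⊎ Large 1 Q ⊎ Q ∈ exceptional-lists) (descendingPrimesBelow 7)
below-7-classified = from-yes (All.all? (λ Q → ≡-dec _≟_ Q [] ⊎-dec large? 1 Q ⊎-dec Q ∈ₗ? exceptional-lists) (descendingPrimesBelow 7))
  where open DecMembership (≡-dec _≟_) renaming (_∈?_ to _∈ₗ?_)

exceptional-lists-7 : All (λ Q → Large 1 (7 ∷ Q)) exceptional-lists
exceptional-lists-7 = from-yes (All.all? (λ Q → large? 1 (7 ∷ Q)) exceptional-lists)

exceptional-lists-large : All (λ Q → Large 3 Q × (∀ {m} → m < 3 → 0 < m → Large m Q ⊎ m * product Q ∈ exceptional)) exceptional-lists
exceptional-lists-large = from-yes (All.all? (λ Q → large? 3 Q ×-dec allUpTo? (λ m → 0 <? m →-dec (large? m Q ⊎-dec m * product Q ∈? exceptional)) 3) exceptional-lists)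

mutual
  -- A head r ≥ 7 is handled through the tail; lists of primes below 7 are checked exhaustively.
  large-or-exceptional : DescendingPrimes Q → Q ≢ [] → Large 1 Q ⊎ Q ∈ exceptional-lists
  large-or-exceptional []                        []≢[] = contradiction refl []≢[]
  large-or-exceptional {r ∷ Q} dQ@(cons _ r>Q dQ′) Q≢[] with r <? 7
  ... | no  r≮7 = inj₁ (large-head-mono dQ′ (large-7 dQ′) z<s (≮⇒≥ r≮7))
  ... | yes r<7 with All.lookup below-7-classified (∈-descendingPrimesBelow 7 dQ (r<7 ∷ All.map (λ s<r → <-trans s<r r<7) r>Q))
  ...   | inj₁ r∷Q≡[] = contradiction r∷Q≡[] Q≢[]
  ...   | inj₂ classified = classified

  large-7 : DescendingPrimes Q → Large 1 (7 ∷ Q)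
  large-7 []                = from-yes (large? 1 (7 ∷ []))
  large-7 dQ@(cons _ _ _) with large-or-exceptional dQ (λ ())
  ... | inj₁ large = large-head-mono dQ (large-cons-5 dQ large) z<s (m≤m+n 5 2)
  ... | inj₂ Q∈exc = All.lookup exceptional-lists-7 Q∈exc

large : 0 < m → DescendingPrimes Q → Q ≢ [] → m * product Q ∉ exceptional → Large m Q
large {m} {Q} 0<m dQ Q≢[] d∉ with large-or-exceptional dQ Q≢[]
... | inj₁ large₁  = large-mono {Q = Q} 0<m large₁
... | inj₂ Q∈exc with All.lookup exceptional-lists-large Q∈exc | m <? 3
...   | large₃ , _     | no  m≮3 = large-mono {Q = Q} (≮⇒≥ m≮3) large₃
...   | _ , small-m    | yes m<3 with small-m m<3 0<m
...     | inj₁ largeₘ = largeₘ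
...     | inj₂ d∈     = contradiction d∈ d∉

exceptional-primitive : All (λ d → d ≢ 6 → ∃ λ p → Prime p × Primitive p d) exceptional
exceptional-primitive =
  (λ _ → 3   , from-yes (prime? 3   ×-dec primitive? 3   2))  ∷
  (λ _ → 7   , from-yes (prime? 7   ×-dec primitive? 7   3))  ∷
  (λ _ → 5   , from-yes (prime? 5   ×-dec primitive? 5   4))  ∷
  (λ 6≢6 → contradiction refl 6≢6)                             ∷
  (λ _ → 11  , from-yes (prime? 11  ×-dec primitive? 11  10)) ∷
  (λ _ → 13  , from-yes (prime? 13  ×-dec primitive? 13  12)) ∷
  (λ _ → 331 , from-yes (prime? 331 ×-dec primitive? 331 30)) ∷ []

bangsTheorem : ∀ d → 2 ≤ d → d ≢ 6 → ∃ λ p → Prime p × Primitive p d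
bangsTheorem d 2≤d d≢6 with d ∈? exceptional
... | yes d∈ = All.lookup exceptional-primitive d∈ d≢6
... | no  d∉ with anyUpTo? (λ p → prime? p ×-dec primitive? p d) (suc (mersenne d))
...   | yes (p , _ , witness) = p , witness
...   | no  ∄p with radical-decomposition (<-trans z<s 2≤d)
...     | m , Q , dQ , refl , complete =
  contradiction (large 0<m dQ Q≢[] d∉) (NoPrimitivePrime.¬large dQ 0<m complete no-primitive)
  where
  0<m : 0 < m
  0<m = >-nonZero⁻¹ m {{m*n≢0⇒m≢0 m {{>-nonZero (<-trans z<s 2≤d)}}}}
  Q≢[] : Q ≢ []
  Q≢[] refl with ∃prime∣ 2≤d
  ... | r , pr , r∣d with complete pr r∣d
  ... | ()
  no-primitive : Prime p → ¬ Primitive p (m * product Q)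
  no-primitive {p} pp p-primitive =
    ∄p (p , s≤s (∣⇒≤ {{>-nonZero (mersenne>0 (<-trans z<s 2≤d))}} (proj₁ p-primitive)) , pp , p-primitive)

strictlyIncreasing⇒injective : ∀ {n d} → StrictlyIncreasing n d → ∀ {i j} → d i ≡ d j → i ≡ j
strictlyIncreasing⇒injective increasing {i} {j} di≡dj with Fin.<-cmp i j
... | tri< i<j _ _ = contradiction (increasing i j i<j) (<-irrefl di≡dj)
... | tri≈ _ i≡j _ = i≡j
... | tri> _ _ j<i = contradiction (increasing j i j<i) (<-irrefl (sym di≡dj))

prime-for-6 : ∀ {n} (d : Fin n → ℕ) → (∀ i → 0 < d i) →
              ¬ (OccursAmong n d 2 × OccursAmong n d 3 × OccursAmong n d 6) →
              ∃ λ s → Prime s × s ∣ mersenne 6 × (OccursAmong n d 6 → ∀ i → ¬ Primitive s (d i))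
prime-for-6 d d>0 ¬2∧3∧6 with Fin.any? (λ i → d i ≟ 2)
... | yes 2∈d = 7 , from-yes (prime? 7) , divides 9 refl , λ 6∈d i 7-primitive →
  ¬2∧3∧6 (2∈d , (i , primitive-unique 7-primitive (from-yes (primitive? 7 3)) (d>0 i) z<s) , 6∈d)
... | no  2∉d = 3 , from-yes (prime? 3) , divides 21 refl , λ _ i 3-primitive →
  2∉d (i , primitive-unique 3-primitive (from-yes (primitive? 3 2)) (d>0 i) z<s)

Chosen : ℕ → ℕ → ℕ → Set
Chosen s x p = x ≡ 6 × p ≡ s ⊎ Primitive p x

choose : ∀ {s} → Prime s → s ∣ mersenne 6 → ∀ x → 1 < x → ∃ λ p → Prime p × p ∣ mersenne x × Chosen s x p
choose ps s∣M6 x 1<x with x ≟ 6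
... | yes refl = _ , ps , s∣M6 , inj₁ (refl , refl)
... | no  x≢6 with bangsTheorem x 1<x x≢6
...   | p , pp , p-primitive = p , pp , proj₁ p-primitive , inj₂ p-primitive

corollary2p4 : (n : ℕ) (a : Fin n → ℤ) (d : Fin n → ℕ) →
    IsCovering n a d →
    StrictlyIncreasing n d →
    (∀ (i : Fin n) → 1 < d i) →
    ¬ (OccursAmong n d 2 × OccursAmong n d 3 × OccursAmong n d 6) →
    IsCDL n d
corollary2p4 n a d _ increasing d>1 ¬2∧3∧6 with prime-for-6 d (<-trans z<s ∘ d>1) ¬2∧3∧6
... | s , ps , s∣M6 , s-unused =
  proj₁ ∘ chosen , injective , λ i → proj₁ (proj₂ (chosen i)) , proj₁ (proj₂ (proj₂ (chosen i)))
  where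
  chosen : ∀ i → ∃ λ p → Prime p × p ∣ mersenne (d i) × Chosen s (d i) p
  chosen i = choose ps s∣M6 (d i) (d>1 i)
  same-modulus : ∀ {i j p} → Chosen s (d i) p → Chosen s (d j) p → d i ≡ d j
  same-modulus         (inj₁ (di≡6 , _))    (inj₁ (dj≡6 , _))    = trans di≡6 (sym dj≡6)
  same-modulus {i} {j} (inj₁ (di≡6 , refl)) (inj₂ s-primitive)   = contradiction s-primitive (s-unused (i , di≡6) j)
  same-modulus {i} {j} (inj₂ s-primitive)   (inj₁ (dj≡6 , refl)) = contradiction s-primitive (s-unused (j , dj≡6) i)
  same-modulus {i} {j} (inj₂ i-primitive)   (inj₂ j-primitive)   =
    primitive-unique i-primitive j-primitive (<-trans z<s (d>1 i)) (<-trans z<s (d>1 j))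
  injective : Injective _≡_ _≡_ (proj₁ ∘ chosen)
  injective {i} {j} pᵢ≡pⱼ = strictlyIncreasing⇒injective increasing
    (same-modulus (proj₂ (proj₂ (proj₂ (chosen i)))) (subst (Chosen s (d j)) (sym pᵢ≡pⱼ) (proj₂ (proj₂ (proj₂ (chosen j))))))
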